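{- Let $U$ be a numeration system satisfying (H1) and (H2). Then there is an integer constant $C>0$ such that for every greedy $U$-representation $w$, there exists $\ell<C$ such that $10^\ell w$ is also a greedy $U$-representation.
   Context: A numeration system is an increasing sequence $U=(U_i)_{i\ge0}$ of integers with $U_0=1$ such that $C_U=\sup_{i}\lceil U_{i+1}/U_i\rceil$ is finite; $A_U=\{0,\ldots,C_U-1\}$. For $n\ge1$, $\operatorname{rep}_U(n)=w_\ell\cdots w_0$ is the unique word over $A_U$ with $n=\sum w_iU_i$, $w_\ell\ne0$ and $\sum_{i=0}^t w_iU_i<U_{t+1}$ for $t=0,\ldots,\ell$; $\operatorname{rep}_U(0)$ is the empty word. A greedy $U$-representation is a word of the form $\operatorname{rep}_U(n)$, $n\in\mathbb{N}$. (H1): the language $\operatorname{rep}_U(\mathbb{N})$ is regular. (H2): $\limsup_{i\to\infty}(U_{i+1}-U_i)=+\infty$. -}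

module Defs where

open import Data.Nat using (ℕ; zero; suc; _+_; _*_; _∸_; _≤_; _<_)
open import Data.Fin using (Fin; toℕ)
open import Data.Bool using (Bool; true)
open import Data.List using (List; []; _∷_; length; reverse; take; map; foldl)
open import Data.Product using (Σ; _×_; ∃; ∃-syntax)
open import Relation.Binary.PropositionalEquality using (_≡_; _≢_)
open import Data.Unit using (⊤)

record IsNumSys (U : ℕ → ℕ) : Set where
  field
    U0≡1    : U 0 ≡ 1
    U-incr  : ∀ i → U i < U (suc i)

-- C is an upper bound of ⌈U(i+1)/U(i)⌉ for all i  (⌈a/b⌉ ≤ C  ⟺  a ≤ C*b for b>0).
IsUpperCU : (ℕ → ℕ) → ℕ → Set
IsUpperCU U C = ∀ i → U (suc i) ≤ C * U i

-- C is C_U = sup_i ⌈U(i+1)/U(i)⌉ (least upper bound); finiteness of C_U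
-- means such a C exists.
IsCU : (ℕ → ℕ) → ℕ → Set
IsCU U C = IsUpperCU U C × (∀ C' → IsUpperCU U C' → C ≤ C')

-- Value of a little-endian digit list starting at position k:
-- valAt U k (d₀ ∷ d₁ ∷ …) = Σ dᵢ U(k+i).
valAt : (ℕ → ℕ) → ℕ → List ℕ → ℕ
valAt U k []       = 0
valAt U k (d ∷ ds) = d * U k + valAt U (suc k) ds

LeadingNonzero : List ℕ → Set
LeadingNonzero []      = ⊤
LeadingNonzero (d ∷ _) = d ≢ 0

-- w = w_ℓ ⋯ w_0 (most significant digit first) is rep_U(n):
-- n = Σ wᵢ Uᵢ, w_ℓ ≠ 0, and Σ_{i≤t} wᵢ Uᵢ < U_{t+1} for t = 0,…,ℓ.
IsRep : (ℕ → ℕ) → ℕ → List ℕ → Set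
IsRep U n w =
  valAt U 0 (reverse w) ≡ n
  × LeadingNonzero w
  × (∀ t → t < length w → valAt U 0 (take (suc t) (reverse w)) < U (suc t))

IsGreedy : (ℕ → ℕ) → List ℕ → Set
IsGreedy U w = ∃[ n ] IsRep U n w

record DFA (A : ℕ) : Set where
  field
    nStates : ℕ
    start   : Fin nStates
    δ       : Fin nStates → Fin A → Fin nStates
    final   : Fin nStates → Bool

accepts : ∀ {A} → DFA A → List (Fin A) → Set
accepts M w = DFA.final M (foldl (DFA.δ M) (DFA.start M) w) ≡ true

-- (H1): rep_U(ℕ) ⊆ A_U* is a regular language, A_U = {0,…,C-1} = Fin C.
H1 : (ℕ → ℕ) → ℕ → Set
H1 U C = Σ (DFA C) λ M → ∀ (w : List (Fin C)) →
  (accepts M w → IsGreedy U (map toℕ w)) × (IsGreedy U (map toℕ w) → accepts M w)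

-- (H2): limsup (U(i+1) - U(i)) = +∞.
H2 : (ℕ → ℕ) → Set
H2 U = ∀ M N → ∃[ i ] (N ≤ i × M ≤ U (suc i) ∸ U i)

-- Given rep_U(n) = w, (H2) yields i ≥ |w| with U(i+1) − U(i) > n, so the
-- greedy conditions for 1 0^ℓ w with ℓ = i − |w| hold: the new top condition is
-- U(i) + n < U(i+1). The digits of w lie in A_U, so w is a word over the
-- alphabet of a DFA M recognising rep_U(ℕ). On reading 1 0^ℓ, M passes through
-- the states after 1, 10, 100, …; among the first N + 1 of them (N the number
-- of states) two coincide, so the state after 1 0^ℓ is already reached after
-- 1 0^ℓ' with ℓ' < N, and M accepts 1 0^ℓ' w as well. Hence C = N + 1 works.
module Submission where

open import Defs
open import Data.Nat using (ℕ; _<_)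
open import Data.List using (List; _∷_; _++_; replicate)
open import Data.Product using (_×_; ∃-syntax)

open import Data.Nat using (zero; suc; _+_; _*_; _∸_; _≤_; z≤n; s≤s; _<?_)
open import Data.Nat.Properties
open import Data.Nat.Induction using (<-rec)
open import Data.Fin using (Fin; zero; suc; toℕ; fromℕ<)
import Data.Fin.Properties as Fin
open import Data.List using ([]; length; reverse; take; map; foldl; _∷ʳ_)
open import Data.List.Properties
  using (++-assoc; ++-identityʳ; foldl-++; length-++; length-replicate; length-reverse; map-++; map-replicate;
         reverse-++; take-all; unfold-reverse)
open import Data.List.Relation.Unary.All using (All; []; _∷_)
open import Data.List.Relation.Binary.Permutation.Propositional.Properties using (All-resp-↭; ↭-reverse)
open import Data.Product using (Σ-syntax; _,_; proj₁; proj₂)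
open import Relation.Binary.PropositionalEquality
open import Relation.Nullary using (yes; no)

take-++ˡ : ∀ {A : Set} n (xs ys : List A) → n ≤ length xs → take n (xs ++ ys) ≡ take n xs
take-++ˡ zero    xs       ys _         = refl
take-++ˡ (suc n) (x ∷ xs) ys (s≤s n≤∣xs∣) = cong (x ∷_) (take-++ˡ n xs ys n≤∣xs∣)

length-∷ʳ : ∀ {A : Set} (xs : List A) (x : A) → length (xs ∷ʳ x) ≡ suc (length xs)
length-∷ʳ xs x = trans (length-++ xs) (+-comm (length xs) 1)

replicate-∷ʳ : ∀ {A : Set} n (x : A) → replicate n x ∷ʳ x ≡ x ∷ replicate n x
replicate-∷ʳ zero    x = refl
replicate-∷ʳ (suc n) x = cong (x ∷_) (replicate-∷ʳ n x)

reverse-replicate : ∀ {A : Set} n (x : A) → reverse (replicate n x) ≡ replicate n x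
reverse-replicate zero    x = refl
reverse-replicate (suc n) x = begin
  reverse (x ∷ replicate n x)    ≡⟨ unfold-reverse x (replicate n x) ⟩
  reverse (replicate n x) ∷ʳ x   ≡⟨ cong (_∷ʳ x) (reverse-replicate n x) ⟩
  replicate n x ∷ʳ x             ≡⟨ replicate-∷ʳ n x ⟩
  x ∷ replicate n x              ∎
  where open ≡-Reasoning

reverse-∷-replicate-++ : ∀ {A : Set} (x y : A) ℓ (w : List A) →
  reverse ((x ∷ replicate ℓ y) ++ w) ≡ (reverse w ++ replicate ℓ y) ∷ʳ x
reverse-∷-replicate-++ x y ℓ w = begin
  reverse ((x ∷ replicate ℓ y) ++ w)           ≡⟨ reverse-++ (x ∷ replicate ℓ y) w ⟩
  reverse w ++ reverse (x ∷ replicate ℓ y)     ≡⟨ cong (reverse w ++_) (unfold-reverse x (replicate ℓ y)) ⟩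
  reverse w ++ (reverse (replicate ℓ y) ∷ʳ x)  ≡⟨ cong (λ v → reverse w ++ (v ∷ʳ x)) (reverse-replicate ℓ y) ⟩
  reverse w ++ (replicate ℓ y ∷ʳ x)            ≡⟨ ++-assoc (reverse w) (replicate ℓ y) (x ∷ []) ⟨
  (reverse w ++ replicate ℓ y) ∷ʳ x            ∎
  where open ≡-Reasoning

map-toℕ-onto : ∀ {n} {xs : List ℕ} → All (_< n) xs → Σ[ is ∈ List (Fin n) ] (map toℕ is ≡ xs)
map-toℕ-onto []           = [] , refl
map-toℕ-onto (x<n ∷ xs<n) =
  let is , map-is≡xs = map-toℕ-onto xs<n
  in fromℕ< x<n ∷ is , cong₂ _∷_ (Fin.toℕ-fromℕ< x<n) map-is≡xs

foldl-replicate-+ : ∀ {A B : Set} (f : A → B → A) s x a b →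
  foldl f s (replicate (a + b) x) ≡ foldl f (foldl f s (replicate a x)) (replicate b x)
foldl-replicate-+ f s x zero    b = refl
foldl-replicate-+ f s x (suc a) b = foldl-replicate-+ f (f s x) x a b

foldl-replicate-pumping : ∀ {N} {A : Set} (f : Fin N → A → Fin N) (s : Fin N) (x : A) ℓ →
  ∃[ ℓ' ] (ℓ' < N × foldl f s (replicate ℓ' x) ≡ foldl f s (replicate ℓ x))
foldl-replicate-pumping {N} f s x with Fin.pigeonhole (n<1+n N) (λ i → foldl f s (replicate (toℕ i) x))
... | i , j , i<j , run-i≡run-j = <-rec _ shorten
  where
  run : ℕ → Fin N
  run k = foldl f s (replicate k x)

  a b : ℕ
  a = toℕ i
  b = toℕ j

  skip : ∀ c → run (a + c) ≡ run (b + c)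
  skip c = begin
    run (a + c)                     ≡⟨ foldl-replicate-+ f s x a c ⟩
    foldl f (run a) (replicate c x) ≡⟨ cong (λ q → foldl f q (replicate c x)) run-i≡run-j ⟩
    foldl f (run b) (replicate c x) ≡⟨ foldl-replicate-+ f s x b c ⟨
    run (b + c)                     ∎
    where open ≡-Reasoning

  ReachedEarly : ℕ → Set
  ReachedEarly m = ∃[ ℓ' ] (ℓ' < N × run ℓ' ≡ run m)

  shorten : ∀ ℓ → (∀ {m} → m < ℓ → ReachedEarly m) → ReachedEarly ℓ
  shorten ℓ shorter with ℓ <? N
  ... | yes ℓ<N = ℓ , ℓ<N , refl
  ... | no ℓ≮N =
    let ℓ' , ℓ'<N , run-ℓ'≡ = shorter a+[ℓ∸b]<ℓ
    in ℓ' , ℓ'<N , trans run-ℓ'≡ (trans (skip (ℓ ∸ b)) (cong run b+[ℓ∸b]≡ℓ))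
    where
    b+[ℓ∸b]≡ℓ : b + (ℓ ∸ b) ≡ ℓ
    b+[ℓ∸b]≡ℓ = m+[n∸m]≡n (≤-trans (≤-pred (Fin.toℕ<n j)) (≮⇒≥ ℓ≮N))
    a+[ℓ∸b]<ℓ : a + (ℓ ∸ b) < ℓ
    a+[ℓ∸b]<ℓ = <-≤-trans (+-monoˡ-< (ℓ ∸ b) i<j) (≤-reflexive b+[ℓ∸b]≡ℓ)

Recognises : ∀ {A} → DFA A → (List ℕ → Set) → Set
Recognises {A} M P = ∀ (w : List (Fin A)) → (accepts M w → P (map toℕ w)) × (P (map toℕ w) → accepts M w)

accepts-pumping : ∀ {A} (M : DFA A) (u v : List (Fin A)) (x : Fin A) ℓ →
  accepts M (u ++ replicate ℓ x ++ v) → ∃[ ℓ' ] (ℓ' < DFA.nStates M × accepts M (u ++ replicate ℓ' x ++ v))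
accepts-pumping M u v x ℓ accepted =
  let ℓ' , ℓ'<N , same-state = foldl-replicate-pumping δ (foldl δ start u) x ℓ
  in ℓ' , ℓ'<N , trans (cong final (begin
       foldl δ start (u ++ replicate ℓ' x ++ v)                  ≡⟨ run-split ℓ' ⟩
       foldl δ (foldl δ (foldl δ start u) (replicate ℓ' x)) v    ≡⟨ cong (λ q → foldl δ q v) same-state ⟩
       foldl δ (foldl δ (foldl δ start u) (replicate ℓ x)) v     ≡⟨ run-split ℓ ⟨
       foldl δ start (u ++ replicate ℓ x ++ v)                   ∎)) accepted
  where
  open DFA M
  open ≡-Reasoning
  run-split : ∀ k → foldl δ start (u ++ replicate k x ++ v)
                  ≡ foldl δ (foldl δ (foldl δ start u) (replicate k x)) v
  run-split k = trans (foldl-++ δ start u _) (foldl-++ δ (foldl δ start u) (replicate k x) v)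

map-toℕ-one-zeros : ∀ {c} ℓ (fw : List (Fin (suc (suc c)))) →
  map toℕ ((suc zero ∷ replicate ℓ zero) ++ fw) ≡ (1 ∷ replicate ℓ 0) ++ map toℕ fw
map-toℕ-one-zeros ℓ fw =
  cong (1 ∷_) (trans (map-++ toℕ (replicate ℓ zero) fw) (cong (_++ map toℕ fw) (map-replicate toℕ ℓ zero)))

leading-one-pumping : ∀ {C} (M : DFA C) (P : List ℕ → Set) → Recognises M P → 2 ≤ C →
  ∀ {w} → All (_< C) w → ∀ ℓ → P ((1 ∷ replicate ℓ 0) ++ w) →
  ∃[ ℓ' ] (ℓ' < DFA.nStates M × P ((1 ∷ replicate ℓ' 0) ++ w))
leading-one-pumping M P recognises (s≤s (s≤s z≤n)) {w} w<C ℓ p =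
  let accepted = proj₂ (recognises _) (subst P (sym (word≡ ℓ)) p)
      ℓ' , ℓ'<N , accepted' = accepts-pumping M (suc zero ∷ []) fw zero ℓ accepted
  in ℓ' , ℓ'<N , subst P (word≡ ℓ') (proj₁ (recognises _) accepted')
  where
  fw = proj₁ (map-toℕ-onto w<C)
  word≡ : ∀ k → map toℕ ((suc zero ∷ replicate k zero) ++ fw) ≡ (1 ∷ replicate k 0) ++ w
  word≡ k = trans (map-toℕ-one-zeros k fw) (cong ((1 ∷ replicate k 0) ++_) (proj₂ (map-toℕ-onto w<C)))

Admissible : (ℕ → ℕ) → List ℕ → Set
Admissible U r = ∀ t → t < length r → valAt U 0 (take (suc t) r) < U (suc t)

module _ {U : ℕ → ℕ} where

  valAt-++ : ∀ k xs ys → valAt U k (xs ++ ys) ≡ valAt U k xs + valAt U (k + length xs) ys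
  valAt-++ k []       ys = cong (λ j → valAt U j ys) (sym (+-identityʳ k))
  valAt-++ k (d ∷ xs) ys = begin
    d * U k + valAt U (suc k) (xs ++ ys)
      ≡⟨ cong (d * U k +_) (valAt-++ (suc k) xs ys) ⟩
    d * U k + (valAt U (suc k) xs + valAt U (suc k + length xs) ys)
      ≡⟨ +-assoc (d * U k) _ _ ⟨
    d * U k + valAt U (suc k) xs + valAt U (suc k + length xs) ys
      ≡⟨ cong (λ j → d * U k + valAt U (suc k) xs + valAt U j ys) (+-suc k (length xs)) ⟨
    d * U k + valAt U (suc k) xs + valAt U (k + suc (length xs)) ys
      ∎
    where open ≡-Reasoning

  valAt-++-zeros : ∀ k r ℓ → valAt U k (r ++ replicate ℓ 0) ≡ valAt U k r
  valAt-++-zeros k r ℓ = begin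
    valAt U k (r ++ replicate ℓ 0)                              ≡⟨ valAt-++ k r (replicate ℓ 0) ⟩
    valAt U k r + valAt U (k + length r) (replicate ℓ 0)        ≡⟨ cong (valAt U k r +_) (zeros (k + length r) ℓ) ⟩
    valAt U k r + 0                                             ≡⟨ +-identityʳ _ ⟩
    valAt U k r                                                 ∎
    where
    open ≡-Reasoning
    zeros : ∀ j ℓ → valAt U j (replicate ℓ 0) ≡ 0
    zeros j zero    = refl
    zeros j (suc ℓ) = zeros (suc j) ℓ

  IsRep⇒Admissible : ∀ {n w} → IsRep U n w → Admissible U (reverse w)
  IsRep⇒Admissible {w = w} (_ , _ , bounded) t t<∣w∣ = bounded t (subst (t <_) (length-reverse w) t<∣w∣)

  Admissible⇒IsGreedy : ∀ w → LeadingNonzero w → Admissible U (reverse w) → IsGreedy U w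
  Admissible⇒IsGreedy w leading admissible =
    _ , refl , leading , λ t t<∣w∣ → admissible t (subst (t <_) (sym (length-reverse w)) t<∣w∣)

  Admissible-∷ʳ : ∀ r {d} → Admissible U r → valAt U 0 (r ∷ʳ d) < U (suc (length r)) → Admissible U (r ∷ʳ d)
  Admissible-∷ʳ r {d} admissible top t t<∣r∷ʳd∣ with t <? length r
  ... | yes t<∣r∣ =
    subst (λ v → valAt U 0 v < U (suc t)) (sym (take-++ˡ (suc t) r (d ∷ []) t<∣r∣)) (admissible t t<∣r∣)
  ... | no t≮∣r∣ rewrite ≤-antisym (≤-pred (subst (t <_) (length-∷ʳ r d) t<∣r∷ʳd∣)) (≮⇒≥ t≮∣r∣) =
    subst (λ v → valAt U 0 v < U (suc (length r))) (sym (take-all _ (r ∷ʳ d) (≤-reflexive (length-∷ʳ r d)))) top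

  Admissible⇒digits< : ∀ {C} → IsUpperCU U C → ∀ {r} → Admissible U r → All (_< C) r
  Admissible⇒digits< {C} upper = from 0 0 _
    where
    from : ∀ k acc r → (∀ t → t < length r → acc + valAt U k (take (suc t) r) < U (k + suc t)) → All (_< C) r
    from k acc []       _       = []
    from k acc (d ∷ ds) bounded = d<C ∷ from (suc k) (acc + d * U k) ds bounded-tail
      where
      d*Uk<C*Uk : d * U k < C * U k
      d*Uk<C*Uk = begin-strict
        d * U k              ≤⟨ m≤m+n (d * U k) 0 ⟩
        d * U k + 0          ≤⟨ m≤n+m _ acc ⟩
        acc + (d * U k + 0)  <⟨ bounded 0 (s≤s z≤n) ⟩
        U (k + 1)            ≡⟨ cong U (+-comm k 1) ⟩
        U (suc k)            ≤⟨ upper k ⟩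
        C * U k              ∎
        where open ≤-Reasoning
      d<C : d < C
      d<C = *-cancelʳ-< (U k) d C d*Uk<C*Uk
      bounded-tail : ∀ t → t < length ds → acc + d * U k + valAt U (suc k) (take (suc t) ds) < U (suc k + suc t)
      bounded-tail t t<∣ds∣ =
        subst₂ _<_ (sym (+-assoc acc _ _)) (cong U (+-suc k (suc t))) (bounded (suc t) (s≤s t<∣ds∣))

  greedy-digits< : ∀ {C} → IsUpperCU U C → ∀ {w} → IsGreedy U w → All (_< C) w
  greedy-digits< upper {w} (_ , rep) = All-resp-↭ (↭-reverse w) (Admissible⇒digits< upper (IsRep⇒Admissible rep))

module _ {U : ℕ → ℕ} (ns : IsNumSys U) where
  open IsNumSys ns

  IsUpperCU⇒2≤ : ∀ {C} → IsUpperCU U C → 2 ≤ C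
  IsUpperCU⇒2≤ {C} upper = begin
    2          ≤⟨ subst (_< U 1) U0≡1 (U-incr 0) ⟩
    U 1        ≤⟨ upper 0 ⟩
    C * U 0    ≡⟨ cong (C *_) U0≡1 ⟩
    C * 1      ≡⟨ *-identityʳ C ⟩
    C          ∎
    where open ≤-Reasoning

  Admissible⇒valAt< : ∀ r → Admissible U r → valAt U 0 r < U (length r)
  Admissible⇒valAt< []       _          = subst (0 <_) (sym U0≡1) (s≤s z≤n)
  Admissible⇒valAt< (d ∷ ds) admissible =
    subst (λ v → valAt U 0 v < U (length (d ∷ ds))) (take-all _ (d ∷ ds) ≤-refl) (admissible (length ds) ≤-refl)

  Admissible-∷ʳ-0 : ∀ r → Admissible U r → Admissible U (r ∷ʳ 0)
  Admissible-∷ʳ-0 r admissible = Admissible-∷ʳ r admissible (begin-strict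
    valAt U 0 (r ∷ʳ 0)   ≡⟨ valAt-++-zeros 0 r 1 ⟩
    valAt U 0 r          <⟨ Admissible⇒valAt< r admissible ⟩
    U (length r)         <⟨ U-incr (length r) ⟩
    U (suc (length r))   ∎)
    where open ≤-Reasoning

  Admissible-++-zeros : ∀ ℓ r → Admissible U r → Admissible U (r ++ replicate ℓ 0)
  Admissible-++-zeros zero    r admissible = subst (Admissible U) (sym (++-identityʳ r)) admissible
  Admissible-++-zeros (suc ℓ) r admissible =
    subst (Admissible U) (++-assoc r (0 ∷ []) (replicate ℓ 0))
      (Admissible-++-zeros ℓ (r ∷ʳ 0) (Admissible-∷ʳ-0 r admissible))

  Admissible-zeros-one : ∀ ℓ r → Admissible U r → valAt U 0 r < U (suc (length r + ℓ)) ∸ U (length r + ℓ) →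
    Admissible U ((r ++ replicate ℓ 0) ∷ʳ 1)
  Admissible-zeros-one ℓ r admissible gap =
    Admissible-∷ʳ padded (Admissible-++-zeros ℓ r admissible) (begin-strict
    valAt U 0 (padded ∷ʳ 1)                  ≡⟨ valAt-++ 0 padded (1 ∷ []) ⟩
    valAt U 0 padded + (1 * U ∣padded∣ + 0)   ≡⟨ cong₂ _+_ (valAt-++-zeros 0 r ℓ) (trans (+-identityʳ _) (+-identityʳ _)) ⟩
    valAt U 0 r + U ∣padded∣                  ≡⟨ cong (λ j → valAt U 0 r + U j) ∣padded∣≡i ⟩
    valAt U 0 r + U i                         <⟨ +-monoˡ-< (U i) gap ⟩
    U (suc i) ∸ U i + U i                     ≡⟨ m∸n+n≡m (<⇒≤ (U-incr i)) ⟩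
    U (suc i)                                 ≡⟨ cong (λ j → U (suc j)) ∣padded∣≡i ⟨
    U (suc ∣padded∣)                          ∎)
    where
    open ≤-Reasoning
    i = length r + ℓ
    padded = r ++ replicate ℓ 0
    ∣padded∣ = length padded
    ∣padded∣≡i : ∣padded∣ ≡ i
    ∣padded∣≡i = trans (length-++ r) (cong (length r +_) (length-replicate ℓ))

  greedy-leading-one : H2 U → ∀ {w} → IsGreedy U w → ∃[ ℓ ] IsGreedy U ((1 ∷ replicate ℓ 0) ++ w)
  greedy-leading-one h2 {w} (n , rep@(value≡n , _)) =
    let i , ∣w∣≤i , gap = h2 (suc n) (length w)
        ℓ = i ∸ length w
        ∣rev-w∣+ℓ≡i = trans (cong (_+ ℓ) (length-reverse w)) (m+[n∸m]≡n ∣w∣≤i)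
        gap' = subst₂ (λ v j → v < U (suc j) ∸ U j) (sym value≡n) (sym ∣rev-w∣+ℓ≡i) gap
        admissible = Admissible-zeros-one ℓ (reverse w) (IsRep⇒Admissible rep) gap'
    in ℓ , Admissible⇒IsGreedy ((1 ∷ replicate ℓ 0) ++ w) (λ ())
             (subst (Admissible U) (sym (reverse-∷-replicate-++ 1 0 ℓ w)) admissible)

lemma3p3 : (U : ℕ → ℕ) (CU : ℕ) → IsNumSys U → IsCU U CU → H1 U CU → H2 U →
    ∃[ C ] (0 < C × (∀ (w : List ℕ) → IsGreedy U w →
    ∃[ ℓ ] (ℓ < C × IsGreedy U ((1 ∷ replicate ℓ 0) ++ w))))
lemma3p3 U CU ns (upper , _) (M , recognises) h2 = suc (DFA.nStates M) , s≤s z≤n , shift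
  where
  shift : ∀ w → IsGreedy U w → ∃[ ℓ ] (ℓ < suc (DFA.nStates M) × IsGreedy U ((1 ∷ replicate ℓ 0) ++ w))
  shift w greedy =
    let ℓ , shifted = greedy-leading-one ns h2 greedy
        ℓ' , ℓ'<N , pumped = leading-one-pumping M (IsGreedy U) recognises (IsUpperCU⇒2≤ ns upper)
                               (greedy-digits< upper greedy) ℓ shifted
    in ℓ' , m<n⇒m<1+n ℓ'<N , pumped
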